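{- Let $n\ge 2$ and let $\sim$ be the relation on the set $\mathcal F_n$ of $n$PC formulas given by $F\sim G$ iff for all $i\in\{1,\dots,n\}$ both $F\vdash_i G$ and $G\vdash_i F$ are provable in $n$PC. Then $\mathcal F_n/\!\sim$, equipped with the operation $q([F_0],[F_1],\dots,[F_n])=[q(F_0,F_1,\dots,F_n)]$ and the constants $[\mathsf e_1],\dots,[\mathsf e_n]$, is a Boolean-like algebra of dimension $n$ (the Lindenbaum algebra $L_n$ of $n$PC).
   Context: Fix $n\ge 2$, write $\hat n=\{1,\dots,n\}$, let $S_n$ be the group of permutations of $\hat n$ and $V$ a countable set of propositional variables. Formulas of $n$PC are: decorated variables $X^\pi$ ($X\in V$, $\pi\in S_n$); constants $\mathsf e_1,\dots,\mathsf e_n$; compound formulas $q(F,G_1,\dots,G_n)$. For $\rho\in S_n$, $F^\rho$ is defined by $(X^\pi)^\rho=X^{\rho\circ\pi}$, $(\mathsf e_k)^\rho=\mathsf e_{\rho(k)}$, $q(F,G_1,\dots,G_n)^\rho=q(F,G_1^\rho,\dots,G_n^\rho)$. $(ij)$ denotes the transposition exchanging $i$ and $j$ (identity if $i=j$). Contexts $\Gamma,\Delta$ are finite multisets of formulas, $\Gamma^\rho$ elementwise. Sequents $\Gamma\vdash_i\Delta$ ($i\in\hat n$) are provable if derivable by the rules (premises $\Rightarrow$ conclusion), for all $i,j,k\in\hat n$: (Const) $\Rightarrow\ \vdash_i\mathsf e_i$. (Id) $\Rightarrow X^\pi\vdash_i X^\rho$ whenever $\pi^{ -1}(i)=\rho^{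 -1}(i)$. (Sym) $\Gamma^{(ij)}\vdash_i\Delta^{(ij)}\Rightarrow\Gamma\vdash_j\Delta$. (Neg1) if $i\ne k$: $\Gamma^{(ij)}\vdash_i F,\Delta^{(ij)}\Rightarrow \Gamma,F^{(jk)}\vdash_j\Delta$. (Neg2) if $j\neq k$: $\Gamma^{(ij)}\vdash_i F,\Delta^{(ij)}\Rightarrow \Gamma,F^{(ik)}\vdash_j\Delta$. (Neg3) $\{\Gamma^{(ij)},F\vdash_i\Delta^{(ij)}\}_{i\neq j}\Rightarrow\Gamma\vdash_j F,\Delta$. (qL) $\{\Gamma^{(ji)},F,G_j^{(ji)}\vdash_j\Delta^{(ji)}\}_{j\in\hat n}\Rightarrow \Gamma,q(F,G_1,\dots,G_n)\vdash_i\Delta$. (qR) $\{\Gamma^{(ji)},F\vdash_j G_j^{(ji)},\Delta^{(ji)}\}_{j\in\hat n}\Rightarrow\Gamma\vdash_i q(F,G_1,\dots,G_n),\Delta$. (Cut) $\Gamma,F\vdash_i\Delta$ and $\Gamma\vdash_i F,\Delta\Rightarrow\Gamma\vdash_i\Delta$. Left and right weakening and contraction in each $\vdash_i$. A Boolean-like algebra of dimension $n$ (in the pure type $(q,\mathsf e_1,\dots,\mathsf e_n)$, $q$ of arity $n+1$) is an algebra $(A,q,\mathsf e_1,\dots,\mathsf e_n)$ satisfying, for all elements: $q(\mathsf e_i,x_1,\dots,x_n)=x_i$ for each $i$; (B1) $q(c,\mathsf e_1,\dots,\mathsf e_n)=c$; (B2) $q(c,x,\dots,x)=x$; (B3) $q(c,q(x^1_0,\dots,x^1_n),\dots,q(x^n_0,\dots,x^n_n))=q(q(c,x^1_0,\dots,x^n_0),q(c,x^1_1,\dots,x^n_1),\dots,q(c,x^1_n,\dots,x^n_n))$.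 -}

module Defs where

open import Data.Nat using (ℕ)
open import Data.Fin using (Fin)
open import Data.Fin.Permutation using (Permutation′; _∘ₚ_; _⟨$⟩ˡ_; _⟨$⟩ʳ_; transpose)
open import Data.List using (List; []; _∷_; [_]; map)
open import Data.List.Relation.Binary.Permutation.Propositional using (_↭_)
open import Relation.Binary.PropositionalEquality using (_≡_; _≢_)
open import Relation.Binary.Structures using (IsEquivalence)
open import Data.Product using (_×_)
open import Level using (Level; _⊔_; suc)

Var : Set
Var = ℕ

-- Formulas of nPC.  Indices 1..n are represented by Fin n.
-- q(F, G_1, ..., G_n) is  q F G  with  G : Fin n → Formula n.
data Formula (n : ℕ) : Set where
  var : Var → Permutation′ n → Formula n
  e   : Fin n → Formula n
  q   : Formula n → (Fin n → Formula n) → Formula n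

module _ {n : ℕ} where

  -- The action F^ρ.  (X^π)^ρ = X^(ρ∘π);  in stdlib  π ∘ₚ ρ  means "first π, then ρ",
  -- i.e. the function ρ ∘ π.
  infixl 30 _^_
  _^_ : Formula n → Permutation′ n → Formula n
  var X π ^ ρ = var X (π ∘ₚ ρ)
  e k ^ ρ = e (ρ ⟨$⟩ʳ k)
  q F G ^ ρ = q F (λ j → G j ^ ρ)

  -- Contexts: finite multisets, represented as lists (with an exchange rule below).
  Ctx : Set
  Ctx = List (Formula n)

  infixl 30 _^ᶜ_
  _^ᶜ_ : Ctx → Permutation′ n → Ctx
  Γ ^ᶜ ρ = map (_^ ρ) Γ

  -- (i j) is  transpose i j  (the identity when i = j).

  infix 4 _⊢[_]_
  data _⊢[_]_ : Ctx → Fin n → Ctx → Set where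
    const : ∀ {i} → [] ⊢[ i ] [ e i ]
    ident : ∀ {i X π ρ} → π ⟨$⟩ˡ i ≡ ρ ⟨$⟩ˡ i → [ var X π ] ⊢[ i ] [ var X ρ ]
    sym   : ∀ {Γ Δ i j} →
            Γ ^ᶜ transpose i j ⊢[ i ] Δ ^ᶜ transpose i j → Γ ⊢[ j ] Δ
    neg1  : ∀ {Γ Δ F i j k} → i ≢ k →
            Γ ^ᶜ transpose i j ⊢[ i ] F ∷ Δ ^ᶜ transpose i j →
            F ^ transpose j k ∷ Γ ⊢[ j ] Δ
    neg2  : ∀ {Γ Δ F i j k} → j ≢ k →
            Γ ^ᶜ transpose i j ⊢[ i ] F ∷ Δ ^ᶜ transpose i j →
            F ^ transpose i k ∷ Γ ⊢[ j ] Δ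
    neg3  : ∀ {Γ Δ F j} →
            (∀ i → i ≢ j → F ∷ Γ ^ᶜ transpose i j ⊢[ i ] Δ ^ᶜ transpose i j) →
            Γ ⊢[ j ] F ∷ Δ
    qL    : ∀ {Γ Δ F G i} →
            (∀ j → F ∷ G j ^ transpose j i ∷ Γ ^ᶜ transpose j i ⊢[ j ] Δ ^ᶜ transpose j i) →
            q F G ∷ Γ ⊢[ i ] Δ
    qR    : ∀ {Γ Δ F G i} →
            (∀ j → F ∷ Γ ^ᶜ transpose j i ⊢[ j ] G j ^ transpose j i ∷ Δ ^ᶜ transpose j i) →
            Γ ⊢[ i ] q F G ∷ Δ
    cut   : ∀ {Γ Δ F i} → F ∷ Γ ⊢[ i ] Δ → Γ ⊢[ i ] F ∷ Δ → Γ ⊢[ i ] Δ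
    weakL : ∀ {Γ Δ F i} → Γ ⊢[ i ] Δ → F ∷ Γ ⊢[ i ] Δ
    weakR : ∀ {Γ Δ F i} → Γ ⊢[ i ] Δ → Γ ⊢[ i ] F ∷ Δ
    contrL : ∀ {Γ Δ F i} → F ∷ F ∷ Γ ⊢[ i ] Δ → F ∷ Γ ⊢[ i ] Δ
    contrR : ∀ {Γ Δ F i} → Γ ⊢[ i ] F ∷ F ∷ Δ → Γ ⊢[ i ] F ∷ Δ
    exch  : ∀ {Γ Γ′ Δ Δ′ i} → Γ ↭ Γ′ → Δ ↭ Δ′ → Γ ⊢[ i ] Δ → Γ′ ⊢[ i ] Δ′

  infix 4 _∼_
  _∼_ : Formula n → Formula n → Set
  F ∼ G = ∀ i → ([ F ] ⊢[ i ] [ G ]) × ([ G ] ⊢[ i ] [ F ])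

-- Boolean-like algebra of dimension n, presented on a setoid (A, ≈):
-- since Agda (without cubical) has no quotient types, "the quotient A/≈ with the
-- induced operations is a BA of dimension n" is expressed as: ≈ is an equivalence,
-- q is compatible with ≈, and the axioms hold up to ≈.
record IsBooleanLikeAlgebra (n : ℕ) {a ℓ : Level} {A : Set a} (_≈_ : A → A → Set ℓ)
       (qq : A → (Fin n → A) → A) (ee : Fin n → A) : Set (a ⊔ ℓ) where
  field
    isEquivalence : IsEquivalence _≈_
    q-cong : ∀ {c c′ : A} {x y : Fin n → A} → c ≈ c′ → (∀ i → x i ≈ y i) → qq c x ≈ qq c′ y
    q-e    : ∀ (i : Fin n) (x : Fin n → A) → qq (ee i) x ≈ x i
    B1     : ∀ (c : A) → qq c ee ≈ c
    B2     : ∀ (c x : A) → qq c (λ _ → x) ≈ x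
    -- B3 with x^k_0 = x₀ k and x^k_j = xs k j  (k, j ∈ 1..n)
    B3     : ∀ (c : A) (x₀ : Fin n → A) (xs : Fin n → Fin n → A) →
             qq c (λ k → qq (x₀ k) (xs k)) ≈ qq (qq c x₀) (λ j → qq c (λ k → xs k j))

-- The i-th coordinate of F^π is the π⁻¹(i)-th coordinate of F: F^π ⊢ᵢ F^ρ when
-- π⁻¹(i) = ρ⁻¹(i), and otherwise F^π, F^ρ ⊢ᵢ is provable by (Neg1).  Read from
-- the i-th sequent, (qL) and (qR) split q c x into the branches c^(j i), x_j,
-- and two selectors c^(j i), c^(k i) with j ≠ k clash.  So under the hypothesis
-- c^(k i) the formula q c x behaves like x_k, and each axiom of a Boolean-like
-- algebra follows by deciding which selector holds.
module Submission where

open import Defs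
open import Data.Nat using (ℕ; _≤_)
open import Data.Fin using (Fin)
open import Data.Fin.Properties using (_≟_)
open import Data.Fin.Permutation
  using (Permutation′; _∘ₚ_; _⟨$⟩ˡ_; _⟨$⟩ʳ_; transpose; id; inverseˡ; inverseʳ)
  renaming (_≈_ to _≈ₚ_)
import Data.Fin.Permutation.Components as PC
open import Data.List using (List; []; _∷_; [_]; _++_)
open import Data.List.Membership.Propositional using (_∈_)
open import Data.List.Membership.Propositional.Properties using (∈-∃++; ∈-++⁺ʳ)
open import Data.List.Relation.Unary.Any using (here; there)
open import Data.List.Relation.Binary.Subset.Propositional using (_⊆_)
open import Data.List.Relation.Binary.Subset.Propositional.Properties
  using (⊆-refl; ∷⁺ʳ; ∈-∷⁺ʳ; xs⊆x∷xs)
open import Data.List.Relation.Binary.Permutation.Propositional using (↭-refl; ↭-sym; ↭-prep)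
open import Data.List.Relation.Binary.Permutation.Propositional.Properties using (shift; ++-comm)
open import Data.List.Relation.Binary.Pointwise using (Pointwise; []; _∷_)
open import Data.Product using (_,_; proj₁; proj₂; swap)
open import Relation.Binary.PropositionalEquality
  using (_≡_; _≢_; refl; cong; subst; subst₂; module ≡-Reasoning)
  renaming (sym to ≡-sym; trans to ≡-trans)
open import Relation.Binary.Structures using (IsEquivalence)
open import Relation.Nullary using (Dec; yes; no)
open import Relation.Nullary.Decidable using (dec-true; dec-false)

pattern ∈₀ = here refl
pattern ∈₁ = there ∈₀
pattern ∈₂ = there ∈₁
pattern ∈₃ = there ∈₂
pattern ∈₄ = there ∈₃

module _ {n : ℕ} where

  private variable
    i j k : Fin n
    π ρ σ : Permutation′ n
    A B C F c c′ : Formula n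
    x y : Fin n → Formula n
    Γ Δ Θ Θ′ Ψ Ψ′ : List (Formula n)

  transpose-left : (i j : Fin n) → PC.transpose i j i ≡ j
  transpose-left i j rewrite dec-true (i ≟ i) refl = refl

  transpose-right : (i j : Fin n) → PC.transpose i j j ≡ i
  transpose-right i j with j ≟ i
  ... | yes j≡i = j≡i
  ... | no _ rewrite dec-true (j ≟ j) refl = refl

  transpose-other : (i j k : Fin n) → k ≢ i → k ≢ j → PC.transpose i j k ≡ k
  transpose-other i j k k≢i k≢j rewrite dec-false (k ≟ i) k≢i | dec-false (k ≟ j) k≢j = refl

  transpose-comm : (i j : Fin n) → transpose i j ≈ₚ transpose j i
  transpose-comm i j k = by-cases (k ≟ i) (k ≟ j)
    where
    by-cases : Dec (k ≡ i) → Dec (k ≡ j) → PC.transpose i j k ≡ PC.transpose j i k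
    by-cases (yes refl) _          = ≡-trans (transpose-left k j) (≡-sym (transpose-right j k))
    by-cases (no _)     (yes refl) = ≡-trans (transpose-right i k) (≡-sym (transpose-left k i))
    by-cases (no k≢i)   (no k≢j)   =
      ≡-trans (transpose-other i j k k≢i k≢j) (≡-sym (transpose-other j i k k≢j k≢i))

  transpose-cancel : (i j : Fin n) → transpose j i ∘ₚ transpose i j ≈ₚ id
  transpose-cancel i j k = PC.transpose-inverse i j

  transpose-involutive : (i j : Fin n) → transpose i j ∘ₚ transpose i j ≈ₚ id
  transpose-involutive i j k =
    ≡-trans (cong (PC.transpose i j) (transpose-comm i j k)) (PC.transpose-inverse i j)

  ⟨$⟩ˡ-cong : π ≈ₚ ρ → ∀ k → π ⟨$⟩ˡ k ≡ ρ ⟨$⟩ˡ k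
  ⟨$⟩ˡ-cong {π} {ρ} π≈ρ k =
    ≡-trans (≡-sym (inverseˡ ρ)) (cong (ρ ⟨$⟩ˡ_) (≡-trans (≡-sym (π≈ρ _)) (inverseʳ π)))

  -- Composition of permutations is associative and unital only pointwise, so
  -- F ^ π ^ σ and F ^ (π ∘ₚ σ) are equal only up to _≃_.

  infix 4 _≃_
  data _≃_ : Formula n → Formula n → Set where
    var≃ : ∀ {X π ρ} → π ≈ₚ ρ → var X π ≃ var X ρ
    e≃   : e k ≃ e k
    q≃   : ∀ {F F′ G G′} → F ≃ F′ → (∀ j → G j ≃ G′ j) → q F G ≃ q F′ G′

  ≃-refl : F ≃ F
  ≃-refl {var X π} = var≃ (λ _ → refl)
  ≃-refl {e k}     = e≃
  ≃-refl {q F G}   = q≃ ≃-refl (λ _ → ≃-refl)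

  ≃-sym : A ≃ B → B ≃ A
  ≃-sym (var≃ π≈ρ)  = var≃ (λ k → ≡-sym (π≈ρ k))
  ≃-sym e≃          = e≃
  ≃-sym (q≃ F≃ G≃)  = q≃ (≃-sym F≃) (λ j → ≃-sym (G≃ j))

  ≃-trans : A ≃ B → B ≃ C → A ≃ C
  ≃-trans (var≃ p) (var≃ p′)    = var≃ (λ k → ≡-trans (p k) (p′ k))
  ≃-trans e≃ e≃                 = e≃
  ≃-trans (q≃ F≃ G≃) (q≃ F≃′ G≃′) = q≃ (≃-trans F≃ F≃′) (λ j → ≃-trans (G≃ j) (G≃′ j))

  ^-cong : π ≈ₚ ρ → A ≃ B → A ^ π ≃ B ^ ρ
  ^-cong {π} π≈ρ (var≃ p) = var≃ (λ k → ≡-trans (cong (π ⟨$⟩ʳ_) (p k)) (π≈ρ _))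
  ^-cong {ρ = ρ} π≈ρ (e≃ {k}) = subst (λ l → e l ≃ e (ρ ⟨$⟩ʳ k)) (≡-sym (π≈ρ k)) e≃
  ^-cong π≈ρ (q≃ F≃ G≃)   = q≃ F≃ (λ j → ^-cong π≈ρ (G≃ j))

  ^-∘ : ∀ F → F ^ π ^ σ ≃ F ^ (π ∘ₚ σ)
  ^-∘ (var X τ) = var≃ (λ _ → refl)
  ^-∘ (e k)     = e≃
  ^-∘ (q F G)   = q≃ ≃-refl (λ j → ^-∘ (G j))

  ^-id : ∀ F → F ^ id ≃ F
  ^-id (var X τ) = var≃ (λ _ → refl)
  ^-id (e k)     = e≃
  ^-id (q F G)   = q≃ ≃-refl (λ j → ^-id (G j))

  ^-≃ : A ≃ F ^ π → A ^ σ ≃ F ^ (π ∘ₚ σ)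
  ^-≃ {F = F} {σ = σ} A≃ = ≃-trans (^-cong {π = σ} {ρ = σ} (λ _ → refl) A≃) (^-∘ F)

  ^-undo : σ ∘ₚ ρ ≈ₚ id → F ≃ F ^ σ ^ ρ
  ^-undo {F = F} σρ≈id = ≃-sym (≃-trans (^-∘ F) (≃-trans (^-cong σρ≈id ≃-refl) (^-id F)))

  ^ᶜ-undo : σ ∘ₚ ρ ≈ₚ id → ∀ Γ → Pointwise _≃_ Γ (Γ ^ᶜ σ ^ᶜ ρ)
  ^ᶜ-undo σρ≈id []      = []
  ^ᶜ-undo σρ≈id (F ∷ Γ) = ^-undo σρ≈id ∷ ^ᶜ-undo σρ≈id Γ

  weakenˡ-++ : ∀ Θ → Γ ⊢[ i ] Δ → Θ ++ Γ ⊢[ i ] Δ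
  weakenˡ-++ []      d = d
  weakenˡ-++ (_ ∷ Θ) d = weakL (weakenˡ-++ Θ d)

  weakenʳ-++ : ∀ Ψ → Γ ⊢[ i ] Δ → Γ ⊢[ i ] Ψ ++ Δ
  weakenʳ-++ []      d = d
  weakenʳ-++ (_ ∷ Ψ) d = weakR (weakenʳ-++ Ψ d)

  weaken-++ : ∀ Θ Ψ → Γ ⊢[ i ] Δ → Γ ++ Θ ⊢[ i ] Δ ++ Ψ
  weaken-++ Θ Ψ d = exch (++-comm Θ _) (++-comm Ψ _) (weakenˡ-++ Θ (weakenʳ-++ Ψ d))

  contractˡ-∈ : A ∈ Γ → A ∷ Γ ⊢[ i ] Δ → Γ ⊢[ i ] Δ
  contractˡ-∈ {A} A∈Γ d with ys , zs , refl ← ∈-∃++ A∈Γ =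
    exch (↭-sym (shift A ys zs)) ↭-refl (contrL (exch (↭-prep A (shift A ys zs)) ↭-refl d))

  contractʳ-∈ : A ∈ Δ → Γ ⊢[ i ] A ∷ Δ → Γ ⊢[ i ] Δ
  contractʳ-∈ {A} A∈Δ d with ys , zs , refl ← ∈-∃++ A∈Δ =
    exch ↭-refl (↭-sym (shift A ys zs)) (contrR (exch ↭-refl (↭-prep A (shift A ys zs)) d))

  absorbˡ : ∀ Θ → Θ ⊆ Γ → Θ ++ Γ ⊢[ i ] Δ → Γ ⊢[ i ] Δ
  absorbˡ []      _   d = d
  absorbˡ (_ ∷ Θ) Θ⊆Γ d = absorbˡ Θ (λ m → Θ⊆Γ (there m)) (contractˡ-∈ (∈-++⁺ʳ Θ (Θ⊆Γ ∈₀)) d)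

  absorbʳ : ∀ Ψ → Ψ ⊆ Δ → Γ ⊢[ i ] Ψ ++ Δ → Γ ⊢[ i ] Δ
  absorbʳ []      _   d = d
  absorbʳ (_ ∷ Ψ) Ψ⊆Δ d = absorbʳ Ψ (λ m → Ψ⊆Δ (there m)) (contractʳ-∈ (∈-++⁺ʳ Ψ (Ψ⊆Δ ∈₀)) d)

  weaken : Θ ⊆ Γ → Ψ ⊆ Δ → Θ ⊢[ i ] Ψ → Γ ⊢[ i ] Δ
  weaken {Θ} {Γ} {Ψ} {Δ} Θ⊆Γ Ψ⊆Δ d = absorbˡ Θ Θ⊆Γ (absorbʳ Ψ Ψ⊆Δ (weaken-++ Γ Δ d))

  ⊢-∈ : [ A ] ⊢[ i ] [ B ] → A ∈ Γ → B ∈ Δ → Γ ⊢[ i ] Δ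
  ⊢-∈ d A∈Γ B∈Δ = weaken (∈-∷⁺ʳ A∈Γ (λ ())) (∈-∷⁺ʳ B∈Δ (λ ())) d

  have : [ A ] ⊢[ i ] [ B ] → A ∈ Γ → B ∷ Γ ⊢[ i ] Δ → Γ ⊢[ i ] Δ
  have A⊢B A∈Γ d = cut d (⊢-∈ A⊢B A∈Γ ∈₀)

  e-refute : k ≢ i → [ e k ] ⊢[ i ] []
  e-refute {k} {i} k≢i =
    subst (λ l → [ e l ] ⊢[ i ] []) (transpose-left i k)
      (neg2 {Γ = []} {Δ = []} {i = i} {k = k} (λ i≡k → k≢i (≡-sym i≡k)) const)

  mutual
    ^-identity : ∀ F (π ρ : Permutation′ n) → A ≃ F ^ π → B ≃ F ^ ρ →
                 π ⟨$⟩ˡ i ≡ ρ ⟨$⟩ˡ i → [ A ] ⊢[ i ] [ B ]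
    ^-identity {i = i} (var X σ) π ρ (var≃ {π = π₁} π₁≈) (var≃ {π = π₂} π₂≈) eq =
      ident (≡-trans (⟨$⟩ˡ-cong {π₁} {σ ∘ₚ π} π₁≈ i)
            (≡-trans (cong (σ ⟨$⟩ˡ_) eq) (≡-sym (⟨$⟩ˡ-cong {π₂} {σ ∘ₚ ρ} π₂≈ i))))
    ^-identity {i = i} (e k) π ρ e≃ e≃ eq with π ⟨$⟩ʳ k ≟ i
    ... | yes πk≡i = subst₂ (λ a b → [ e a ] ⊢[ i ] [ e b ]) (≡-sym πk≡i) (≡-sym ρk≡i) (weakL const)
      where
      open ≡-Reasoning
      ρk≡i : ρ ⟨$⟩ʳ k ≡ i
      ρk≡i = begin
        ρ ⟨$⟩ʳ k                   ≡⟨ cong (ρ ⟨$⟩ʳ_) (inverseˡ π) ⟨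
        ρ ⟨$⟩ʳ (π ⟨$⟩ˡ (π ⟨$⟩ʳ k)) ≡⟨ cong (λ l → ρ ⟨$⟩ʳ (π ⟨$⟩ˡ l)) πk≡i ⟩
        ρ ⟨$⟩ʳ (π ⟨$⟩ˡ i)          ≡⟨ cong (ρ ⟨$⟩ʳ_) eq ⟩
        ρ ⟨$⟩ʳ (ρ ⟨$⟩ˡ i)          ≡⟨ inverseʳ ρ ⟩
        i                         ∎
    ... | no πk≢i = weakR (e-refute πk≢i)
    ^-identity {i = i} (q F K) π ρ (q≃ {F₁} {G = K₁} F₁≃ K₁≃) (q≃ {F₂} {G = K₂} F₂≃ K₂≃) eq =
      qL λ j → qR λ m → branch j m
      where
      branch : ∀ j m → F₂ ∷ F₁ ^ transpose m j ∷ K₁ j ^ transpose j i ^ transpose m j ∷ []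
                         ⊢[ m ] [ K₂ m ^ transpose j i ^ transpose m j ]
      branch j m with m ≟ j
      ... | yes refl = ⊢-∈ (^-identity (K m) _ _ (^-≃ (^-≃ (K₁≃ m))) (^-≃ (^-≃ (K₂≃ m)))
                              (subst (λ l → π ⟨$⟩ˡ l ≡ ρ ⟨$⟩ˡ l) (≡-sym back-to-i) eq)) ∈₂ ∈₀
        where
        back-to-i : PC.transpose i m (PC.transpose m m m) ≡ i
        back-to-i = ≡-trans (cong (PC.transpose i m) (transpose-left m m)) (transpose-right i m)
      ... | no m≢j = weaken-++ _ _
        (^-clash F id (transpose m j) (≃-trans F₂≃ (≃-sym (^-id F))) (^-cong (λ _ → refl) F₁≃)
                 (λ m≡j′ → m≢j (≡-trans m≡j′ (transpose-right j m))))

    ^-clash : ∀ F (π ρ : Permutation′ n) → A ≃ F ^ π → B ≃ F ^ ρ →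
              π ⟨$⟩ˡ i ≢ ρ ⟨$⟩ˡ i → A ∷ B ∷ [] ⊢[ i ] []
    ^-clash {A} {B} {i} F π ρ A≃ B≃ π≢ρ =
      cut {F = B ^ transpose i m} (weaken (∷⁺ʳ _ (xs⊆x∷xs _ A)) ⊆-refl Bᵐ,B⊢) (⊢-∈ A⊢Bᵐ ∈₀ ∈₀)
      where
      m : Fin n
      m = ρ ⟨$⟩ʳ (π ⟨$⟩ˡ i)
      i≢m : i ≢ m
      i≢m i≡m = π≢ρ (≡-sym (≡-trans (cong (ρ ⟨$⟩ˡ_) i≡m) (inverseˡ ρ)))
      Bᵐ,B⊢ : B ^ transpose i m ∷ B ∷ [] ⊢[ i ] []
      Bᵐ,B⊢ = neg1 {Γ = [ B ]} {Δ = []} {i = i} i≢m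
        (^-identity F (ρ ∘ₚ transpose i i) ρ (^-≃ B≃) B≃ (cong (ρ ⟨$⟩ˡ_) (transpose-left i i)))
      A⊢Bᵐ : [ A ] ⊢[ i ] [ B ^ transpose i m ]
      A⊢Bᵐ = ^-identity F π (ρ ∘ₚ transpose i m) A≃ (^-≃ B≃)
        (≡-sym (≡-trans (cong (ρ ⟨$⟩ˡ_) (transpose-right m i)) (inverseˡ ρ)))

  identity : A ≃ B → [ A ] ⊢[ i ] [ B ]
  identity {B = B} A≃B = ^-identity B id id (≃-trans A≃B (≃-sym (^-id B))) (≃-sym (^-id B)) refl

  axiom-∈ : A ∈ Γ → A ∈ Δ → Γ ⊢[ i ] Δ
  axiom-∈ = ⊢-∈ (identity ≃-refl)

  clash-∈ : j ≢ k → F ^ transpose j i ∈ Γ → F ^ transpose k i ∈ Γ → Γ ⊢[ i ] Δ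
  clash-∈ {j} {k} {F} {i} j≢k Fʲ∈Γ Fᵏ∈Γ =
    weaken (∈-∷⁺ʳ Fʲ∈Γ (∈-∷⁺ʳ Fᵏ∈Γ (λ ()))) (λ ())
      (^-clash F (transpose j i) (transpose k i) ≃-refl ≃-refl
         (λ j≡k → j≢k (≡-trans (≡-sym (transpose-left i j)) (≡-trans j≡k (transpose-left i k)))))

  cut-≃ˡ : Pointwise _≃_ Θ Θ′ → Θ′ ⊆ Γ → Θ ++ Γ ⊢[ i ] Δ → Γ ⊢[ i ] Δ
  cut-≃ˡ [] _ d = d
  cut-≃ˡ {Θ = A ∷ Θ} (A≃B ∷ Θ≃) Θ′⊆Γ d =
    cut-≃ˡ Θ≃ (λ m → Θ′⊆Γ (there m)) (cut d (⊢-∈ (identity (≃-sym A≃B)) (∈-++⁺ʳ Θ (Θ′⊆Γ ∈₀)) ∈₀))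

  cut-≃ʳ : Pointwise _≃_ Ψ Ψ′ → Ψ′ ⊆ Δ → Γ ⊢[ i ] Ψ ++ Δ → Γ ⊢[ i ] Δ
  cut-≃ʳ [] _ d = d
  cut-≃ʳ {Ψ = A ∷ Ψ} (A≃B ∷ Ψ≃) Ψ′⊆Δ d =
    cut-≃ʳ Ψ≃ (λ m → Ψ′⊆Δ (there m)) (cut (⊢-∈ (identity A≃B) ∈₀ (∈-++⁺ʳ Ψ (Ψ′⊆Δ ∈₀))) d)

  ⊢-resp-≃ : ∀ {Γ′ Δ′} → Pointwise _≃_ Γ Γ′ → Pointwise _≃_ Δ Δ′ → Γ ⊢[ i ] Δ → Γ′ ⊢[ i ] Δ′
  ⊢-resp-≃ Γ≃ Δ≃ d = cut-≃ˡ Γ≃ ⊆-refl (cut-≃ʳ Δ≃ ⊆-refl (weaken-++ _ _ d))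

  ⊢-transpose : Γ ⊢[ i ] Δ → Γ ^ᶜ transpose i j ⊢[ j ] Δ ^ᶜ transpose i j
  ⊢-transpose {Γ} {i} {Δ} {j} d =
    sym (⊢-resp-≃ (^ᶜ-undo (transpose-involutive i j) Γ) (^ᶜ-undo (transpose-involutive i j) Δ) d)

  q-left : (∀ j → F ^ transpose j i ∷ x j ∷ Γ ⊢[ i ] Δ) → q F x ∷ Γ ⊢[ i ] Δ
  q-left {i = i} {Γ = Γ} {Δ = Δ} h = qL λ j → sym {i = i}
    (⊢-resp-≃ (^-cong (transpose-comm j i) ≃-refl ∷ ^-undo (transpose-cancel i j)
                 ∷ ^ᶜ-undo (transpose-cancel i j) Γ)
              (^ᶜ-undo (transpose-cancel i j) Δ)
              (h j))

  q-right : (∀ j → F ^ transpose j i ∷ Γ ⊢[ i ] x j ∷ Δ) → Γ ⊢[ i ] q F x ∷ Δ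
  q-right {i = i} {Γ = Γ} {Δ = Δ} h = qR λ j → sym {i = i}
    (⊢-resp-≃ (^-cong (transpose-comm j i) ≃-refl ∷ ^ᶜ-undo (transpose-cancel i j) Γ)
              (^-undo (transpose-cancel i j) ∷ ^ᶜ-undo (transpose-cancel i j) Δ) (h j))

  q-caseˡ : q F x ∈ Γ → (∀ j → F ^ transpose j i ∷ x j ∷ Γ ⊢[ i ] Δ) → Γ ⊢[ i ] Δ
  q-caseˡ qFx∈Γ h = contractˡ-∈ qFx∈Γ (q-left h)

  q-caseʳ : q F x ∈ Δ → (∀ j → F ^ transpose j i ∷ Γ ⊢[ i ] x j ∷ Δ) → Γ ⊢[ i ] Δ
  q-caseʳ qFx∈Δ h = contractʳ-∈ qFx∈Δ (q-right h)

  q-selectˡ : ∀ {i k F x Γ Δ} → q F x ∈ Γ → F ^ transpose k i ∈ Γ → x k ∷ Γ ⊢[ i ] Δ → Γ ⊢[ i ] Δ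
  q-selectˡ {i} {k} {F} {x} {Γ} {Δ} qFx∈Γ Fᵏ∈Γ d = q-caseˡ qFx∈Γ branch
    where
    branch : ∀ j → F ^ transpose j i ∷ x j ∷ Γ ⊢[ i ] Δ
    branch j with j ≟ k
    ... | yes refl = weakL d
    ... | no j≢k   = clash-∈ j≢k ∈₀ (there (there Fᵏ∈Γ))

  q-selectʳ : ∀ {i k F x Γ Δ} → q F x ∈ Δ → F ^ transpose k i ∈ Γ → Γ ⊢[ i ] x k ∷ Δ → Γ ⊢[ i ] Δ
  q-selectʳ {i} {k} {F} {x} {Γ} {Δ} qFx∈Δ Fᵏ∈Γ d = q-caseʳ qFx∈Δ branch
    where
    branch : ∀ j → F ^ transpose j i ∷ Γ ⊢[ i ] x j ∷ Δ
    branch j with j ≟ k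
    ... | yes refl = weakL d
    ... | no j≢k   = clash-∈ j≢k ∈₀ (there Fᵏ∈Γ)

  ⊢-trans : [ A ] ⊢[ i ] [ B ] → [ B ] ⊢[ i ] [ C ] → [ A ] ⊢[ i ] [ C ]
  ⊢-trans A⊢B B⊢C = cut (⊢-∈ B⊢C ∈₀ ∈₀) (⊢-∈ A⊢B ∈₀ ∈₀)

  ∼-isEquivalence : IsEquivalence (_∼_ {n})
  ∼-isEquivalence = record
    { refl  = λ i → identity ≃-refl , identity ≃-refl
    ; sym   = λ A∼B i → swap (A∼B i)
    ; trans = λ A∼B B∼C i → ⊢-trans (proj₁ (A∼B i)) (proj₁ (B∼C i))
                          , ⊢-trans (proj₂ (B∼C i)) (proj₂ (A∼B i))
    }

  q-mono : (∀ j → [ c ] ⊢[ j ] [ c′ ]) → (∀ j → [ x j ] ⊢[ i ] [ y j ]) →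
           [ q c x ] ⊢[ i ] [ q c′ y ]
  q-mono c⊢c′ x⊢y = q-caseˡ ∈₀ λ j →
    have (⊢-transpose (c⊢c′ j)) ∈₀ (q-selectʳ ∈₀ ∈₀ (⊢-∈ (x⊢y j) ∈₂ ∈₀))

  q-cong-∼ : c ∼ c′ → (∀ j → x j ∼ y j) → q c x ∼ q c′ y
  q-cong-∼ c∼c′ x∼y i = q-mono (λ j → proj₁ (c∼c′ j)) (λ j → proj₁ (x∼y j i))
                      , q-mono (λ j → proj₂ (c∼c′ j)) (λ j → proj₂ (x∼y j i))

  e-selector : Γ ⊢[ i ] e k ^ transpose k i ∷ Δ
  e-selector {i = i} {k} =
    weaken (λ ()) (∷⁺ʳ _ (λ ()))
      (subst (λ l → [] ⊢[ i ] [ e l ]) (≡-sym (transpose-left k i)) const)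

  q-e-∼ : q (e k) x ∼ x k
  q-e-∼ {k} i = cut (q-selectˡ ∈₁ ∈₀ (axiom-∈ ∈₀ ∈₀)) (e-selector {k = k})
              , cut (q-selectʳ ∈₀ ∈₀ (axiom-∈ ∈₁ ∈₀)) (e-selector {k = k})

  q-c-e-∼ : q c e ∼ c
  q-c-e-∼ {c} i = q-caseˡ ∈₀ elim , q-caseʳ ∈₀ intro
    where
    elim : ∀ j → c ^ transpose j i ∷ e j ∷ [ q c e ] ⊢[ i ] [ c ]
    elim j with j ≟ i
    ... | yes refl =
      ⊢-∈ (^-identity c (transpose i i) id ≃-refl (≃-sym (^-id c)) (transpose-left i i)) ∈₀ ∈₀
    ... | no j≢i   = weaken (∈-∷⁺ʳ ∈₁ (λ ())) (λ ()) (e-refute j≢i)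
    intro : ∀ j → c ^ transpose j i ∷ [ c ] ⊢[ i ] e j ∷ [ q c e ]
    intro j with j ≟ i
    ... | yes refl = weaken (λ ()) (∷⁺ʳ _ (λ ())) const
    ... | no j≢i   = weaken ⊆-refl (λ ())
      (^-clash c (transpose j i) id ≃-refl (≃-sym (^-id c))
         (λ j≡i → j≢i (≡-trans (≡-sym (transpose-left i j)) j≡i)))

  q-c-const-∼ : q c (λ _ → A) ∼ A
  q-c-const-∼ i = q-caseˡ ∈₀ (λ _ → axiom-∈ ∈₁ ∈₀) , q-caseʳ ∈₀ (λ _ → axiom-∈ ∈₁ ∈₀)

  q-distrib-∼ : ∀ (x₀ : Fin n → Formula n) (xs : Fin n → Fin n → Formula n) →
                q c (λ k → q (x₀ k) (xs k)) ∼ q (q c x₀) (λ j → q c (λ k → xs k j))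
  q-distrib-∼ {c} x₀ xs i = expand , collect
    where
    expand : [ q c (λ k → q (x₀ k) (xs k)) ] ⊢[ i ] [ q (q c x₀) (λ j → q c (λ k → xs k j)) ]
    expand = q-caseˡ ∈₀ λ k → q-caseˡ ∈₁ λ j → q-caseʳ ∈₀ λ m → q-selectˡ ∈₀ ∈₃ (match k j m)
      where
      match : ∀ k j m → x₀ k ^ transpose m i ∷ q c x₀ ^ transpose m i ∷ x₀ k ^ transpose j i
                        ∷ xs k j ∷ c ^ transpose k i ∷ q (x₀ k) (xs k)
                        ∷ [ q c (λ k → q (x₀ k) (xs k)) ]
                        ⊢[ i ] q c (λ k → xs k m) ∷ [ q (q c x₀) (λ j → q c (λ k → xs k j)) ]
      match k j m with m ≟ j
      ... | yes refl = q-selectʳ ∈₀ ∈₄ (axiom-∈ ∈₃ ∈₀)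
      ... | no m≢j   = clash-∈ m≢j ∈₀ ∈₂
    collect : [ q (q c x₀) (λ j → q c (λ k → xs k j)) ] ⊢[ i ] [ q c (λ k → q (x₀ k) (xs k)) ]
    collect = q-caseʳ ∈₀ λ k → q-caseˡ ∈₁ λ j →
      q-selectˡ ∈₀ ∈₂ (q-selectˡ ∈₂ ∈₃ (q-selectʳ ∈₀ ∈₁ (axiom-∈ ∈₀ ∈₀)))

theorem4p6 : (n : ℕ) → 2 ≤ n → IsBooleanLikeAlgebra n (_∼_ {n}) (q {n}) (e {n})
theorem4p6 n _ = record
  { isEquivalence = ∼-isEquivalence
  ; q-cong        = q-cong-∼
  ; q-e           = λ k x → q-e-∼
  ; B1            = λ c → q-c-e-∼
  ; B2            = λ c x → q-c-const-∼
  ; B3            = λ c → q-distrib-∼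
  }
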